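{- Let $k\geq 5$. Let $\bar r=(r_1,\ldots,r_k)$ with $r_i\geq 1$ for all $i$, and let $0\leq\alpha\leq\sum_{i=1}^k r_i-2$. Let $m\in[1,k]$ be the integer with $\sum_{i=1}^{m-1} r_i\leq\alpha<\sum_{i=1}^m r_i$. Let $\mathcal{A}=(a_1,\ldots,a_k)_{\bar r}$ be a sequence of integers with $0=a_1<a_2<\cdots<a_k$ and \[|\Sigma_{\alpha}(\bar r,\mathcal{A})|=\sum_{i=1}^k (i-1) r_i-\sum_{i=1}^m (i-1) r_i+(m-1)\left(\sum_{i=1}^m r_i-\alpha\right)+1.\] Then $\mathcal{A}=a_2*[0,k-1]_{\bar r}$.
   Context: For distinct integers $a_1,\ldots,a_k$ and $\bar r=(r_1,\ldots,r_k)$ with $r_i\geq 1$, $(a_1,\ldots,a_k)_{\bar r}$ denotes the finite sequence consisting of $r_i$ copies of $a_i$ for each $i$. For such a sequence $\mathcal{A}$ and an integer $0\leq\alpha\leq\sum_i r_i$, $\Sigma_{\alpha}(\bar r,\mathcal{A})$ is the set of sums $s(\mathcal{B})$ of all terms of $\mathcal{B}$, over all subsequences $\mathcal{B}$ of $\mathcal{A}$ of length at least $\alpha$ (the empty subsequence has sum $0$). For integers $a\leq b$ with $b-a+1=k$, $[a,b]_{\bar r}$ denotes the sequence $(a,a+1,\ldots,b)_{\bar r}$, and for a positive integer $c$, $c*(a_1,\ldots,a_k)_{\bar r}=(ca_1,\ldots,ca_k)_{\bar r}$. Empty sums are $0$. -}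

module Defs where

open import Data.Nat using (ℕ; _≤_)
open import Data.Integer using (ℤ)
import Data.Integer as ℤ
open import Data.Fin using (Fin)
open import Data.List using (List; concat; map; replicate; allFin; length; take)
import Data.List as L
open import Data.List.Membership.Propositional using (_∈_)
open import Data.List.Relation.Unary.Unique.Propositional using (Unique)
open import Data.List.Relation.Binary.Sublist.Propositional using (_⊆_)
open import Data.Nat.ListAction using () renaming (sum to sumℕ)
open import Data.Product using (Σ; _×_; ∃)
open import Function.Bundles using (_⇔_)
open import Relation.Binary.PropositionalEquality using (_≡_)

-- (a_1,...,a_k)_r̄ : r_i copies of a_i, in order (indices are 0-based Fin k)
expand : ∀ {k} → (Fin k → ℕ) → (Fin k → ℤ) → List ℤ
expand {k} r a = concat (map (λ i → replicate (r i) (a i)) (allFin k))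

sumℤ : List ℤ → ℤ
sumℤ = L.foldr ℤ._+_ (ℤ.+ 0)

-- x ∈ Σ_α(r̄, A): x is the sum of a subsequence B of A of length ≥ α
InSigma : ℕ → List ℤ → ℤ → Set
InSigma α A x = Σ (List ℤ) λ B → (B ⊆ A) × (α ≤ length B) × (sumℤ B ≡ x)

HasCard : (ℤ → Set) → ℕ → Set
HasCard P N = Σ (List ℤ) λ L → Unique L × (∀ x → (x ∈ L) ⇔ P x) × (length L ≡ N)

-- Σ_{i=1}^{j} f_i  (in 0-based indexing: sum of f i over toℕ i < j)
prefixSum : ∀ {k} → ℕ → (Fin k → ℕ) → ℕ
prefixSum {k} j f = sumℕ (map f (take j (allFin k)))

totalSum : ∀ {k} → (Fin k → ℕ) → ℕ
totalSum {k} f = sumℕ (map f (allFin k))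

-- Write B t for the (t+1)-st value of the sequence, n = Σ rᵢ and β = n ∸ α.
-- The map x ↦ Σ𝒜 − x sends Σ_α onto the set D of sums of at most β terms.
-- With the indices listed in decreasing order, the sums B₁ < … < B_K <
-- B_K + B₁ < … give 1 + (sum of the β largest indices) elements of D, which is
-- exactly the assumed cardinality; so they are all of D, and every increasing
-- list of elements of D up to V = B_K + B_{K−1} that is as long as their part
-- up to V, namely 0, B₁, …, B_K, B_K + B₁, …, B_K + B_{K−1}, equals it. Other
-- such lists, e.g. 0, B₁, …, B_s, B₁ + B_s, B₁ + B_{s+1}, …, force
-- B₁ + B_s = B_{s+1} and B₂ + B₃ = B₁ + B₄, hence B_t = t B₁.

module Submission where

open import Defs
open import Data.Nat using (ℕ; _≤_; _<_; _+_; _*_; _∸_)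
open import Data.Integer using (ℤ; +_)
import Data.Integer as ℤ
open import Data.Fin using (Fin; toℕ)
import Data.Fin as F
open import Relation.Binary.PropositionalEquality using (_≡_)

open import Data.Empty using (⊥-elim)
open import Data.Fin.Properties using (toℕ-fromℕ<; toℕ<n)
open import Data.Integer using ()
  renaming (_+_ to _+ℤ_; _-_ to _-ℤ_; _*_ to _*ℤ_; _<_ to _<ℤ_; _≤_ to _≤ℤ_)
import Data.Integer.Properties as ℤₚ
open import Algebra.Properties.AbelianGroup ℤₚ.+-0-abelianGroup using (∙-cancelʳ; x≈z//y)
import Data.Integer.Solver as ℤ-Solver
open import Data.List
  using (List; []; _∷_; _++_; map; replicate; take; drop; length; concat; reverse;
         applyUpTo; allFin; tabulate; head)
open import Data.List.Properties
  using (length-++; length-map; length-replicate; length-reverse; length-applyUpTo; map-++;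
         map-replicate; map-∘; map-cong; map-tabulate; take-map; reverse-++; unfold-reverse;
         ++-assoc; ++-cancelˡ; ++-cancelʳ; ∷-injectiveˡ)
open import Data.List.Membership.Propositional using (_∈_)
open import Data.List.Membership.Propositional.Properties using (∈-∃++; ∈-map⁺; ∈-++⁺ˡ; ∈-++⁺ʳ)
open import Data.List.Membership.DecPropositional ℤₚ._≟_ using (_∈?_)
open import Data.List.Relation.Binary.Subset.Propositional using () renaming (_⊆_ to _⊆ₛ_)
open import Data.List.Relation.Binary.Sublist.Propositional
  using (_⊆_; []; _∷_; _∷ʳ_; from∈; minimum)
import Data.List.Relation.Binary.Sublist.Propositional.Properties as Sublist
open import Data.List.Relation.Unary.All as All using (All; []; _∷_)
import Data.List.Relation.Unary.All.Properties as Allₚ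
open import Data.List.Relation.Unary.AllPairs as AllPairs using (AllPairs; []; _∷_)
import Data.List.Relation.Unary.AllPairs.Properties as AllPairsₚ
open import Data.List.Relation.Unary.Any using (here; there)
open import Data.List.Relation.Unary.Unique.Propositional using (Unique)
open import Data.Maybe.Properties using (just-injective)
open import Data.Nat using (zero; suc; z≤n; s≤s)
import Data.Nat.Properties as ℕₚ
open import Data.Nat.ListAction using () renaming (sum to sumℕ)
open import Data.Nat.ListAction.Properties using (sum-++)
import Data.Nat.Solver as ℕ-Solver
open import Data.Product using (Σ; _×_; _,_; proj₁; proj₂)
open import Data.Sum using (_⊎_; inj₁; inj₂)
open import Data.Unit using (⊤; tt)
open import Function using (_∘_)
open import Function.Bundles using (Equivalence)
open import Relation.Binary.PropositionalEquality
  using (_≢_; refl; sym; trans; cong; cong₂; subst; subst₂; module ≡-Reasoning)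
open import Relation.Nullary using (yes; no)

open ≡-Reasoning

take-++-length : ∀ {A : Set} (xs : List A) m {ys} → take (length xs + m) (xs ++ ys) ≡ xs ++ take m ys
take-++-length [] m = refl
take-++-length (x ∷ xs) m = cong (x ∷_) (take-++-length xs m)

take-++-≤ : ∀ {A : Set} {m} (xs : List A) {ys} → m ≤ length xs → take m (xs ++ ys) ≡ take m xs
take-++-≤ {m = zero} xs _ = refl
take-++-≤ {m = suc m} (x ∷ xs) (s≤s m≤xs) = cong (x ∷_) (take-++-≤ xs m≤xs)

length-take-≤ : ∀ {A : Set} {m} (xs : List A) → m ≤ length xs → length (take m xs) ≡ m
length-take-≤ {m = zero} xs _ = refl
length-take-≤ {m = suc m} (x ∷ xs) (s≤s m≤xs) = cong suc (length-take-≤ xs m≤xs)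

sum-take-≤ : ∀ m xs → sumℕ (take m xs) ≤ sumℕ xs
sum-take-≤ zero xs = z≤n
sum-take-≤ (suc m) [] = z≤n
sum-take-≤ (suc m) (x ∷ xs) = ℕₚ.+-monoʳ-≤ x (sum-take-≤ m xs)

sum-map-suc : ∀ xs → sumℕ (map suc xs) ≡ length xs + sumℕ xs
sum-map-suc [] = refl
sum-map-suc (x ∷ xs) = cong suc (begin
  x + sumℕ (map suc xs)       ≡⟨ cong (_+_ x) (sum-map-suc xs) ⟩
  x + (length xs + sumℕ xs)   ≡⟨ ℕₚ.+-comm x _ ⟩
  length xs + sumℕ xs + x     ≡⟨ ℕₚ.+-assoc (length xs) _ x ⟩
  length xs + (sumℕ xs + x)   ≡⟨ cong (_+_ (length xs)) (ℕₚ.+-comm (sumℕ xs) x) ⟩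
  length xs + (x + sumℕ xs)   ∎)

sum-replicate-0 : ∀ n → sumℕ (replicate n 0) ≡ 0
sum-replicate-0 zero = refl
sum-replicate-0 (suc n) = sum-replicate-0 n

sum-take-replicate-0 : ∀ m n → sumℕ (take m (replicate n 0)) ≡ 0
sum-take-replicate-0 m n =
  ℕₚ.n≤0⇒n≡0 (subst (sumℕ (take m (replicate n 0)) ≤_) (sum-replicate-0 n) (sum-take-≤ m (replicate n 0)))

sum-map-+ : ∀ {A : Set} (f g : A → ℕ) xs →
  sumℕ (map (λ x → f x + g x) xs) ≡ sumℕ (map f xs) + sumℕ (map g xs)
sum-map-+ f g [] = refl
sum-map-+ f g (x ∷ xs) = trans (cong (_+_ (f x + g x)) (sum-map-+ f g xs))
  (solve 4 (λ a b c d → a :+ b :+ (c :+ d) := a :+ c :+ (b :+ d)) refl (f x) (g x) _ _)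
  where open ℕ-Solver.+-*-Solver

sum-take-map-suc : ∀ {β} xs {ys} → β ≤ length xs → sumℕ (take β (map suc xs ++ ys)) ≡ β + sumℕ (take β xs)
sum-take-map-suc {β} xs β≤xs = begin
  sumℕ (take β (map suc xs ++ _))
    ≡⟨ cong sumℕ (take-++-≤ (map suc xs) (subst (β ≤_) (sym (length-map suc xs)) β≤xs)) ⟩
  sumℕ (take β (map suc xs))              ≡⟨ cong sumℕ (take-map β xs) ⟩
  sumℕ (map suc (take β xs))              ≡⟨ sum-map-suc (take β xs) ⟩
  length (take β xs) + sumℕ (take β xs)   ≡⟨ cong (_+ sumℕ (take β xs)) (length-take-≤ xs β≤xs) ⟩
  β + sumℕ (take β xs)                    ∎

replicate-∷ʳ : ∀ {A : Set} n (x : A) → replicate n x ++ x ∷ [] ≡ x ∷ replicate n x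
replicate-∷ʳ zero x = refl
replicate-∷ʳ (suc n) x = cong (x ∷_) (replicate-∷ʳ n x)

reverse-replicate : ∀ {A : Set} n (x : A) → reverse (replicate n x) ≡ replicate n x
reverse-replicate zero x = refl
reverse-replicate (suc n) x = begin
  reverse (x ∷ replicate n x)        ≡⟨ unfold-reverse x (replicate n x) ⟩
  reverse (replicate n x) ++ x ∷ []  ≡⟨ cong (_++ x ∷ []) (reverse-replicate n x) ⟩
  replicate n x ++ x ∷ []            ≡⟨ replicate-∷ʳ n x ⟩
  x ∷ replicate n x                  ∎

∈-remove : ∀ {A : Set} {x z : A} xs {ys} → z ∈ xs ++ x ∷ ys → z ≢ x → z ∈ xs ++ ys
∈-remove [] (here refl) z≢x = ⊥-elim (z≢x refl)
∈-remove [] (there z∈) _ = z∈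
∈-remove (y ∷ xs) (here z≡y) _ = here z≡y
∈-remove (y ∷ xs) (there z∈) z≢x = there (∈-remove xs z∈ z≢x)

length-++-∷ : ∀ {A : Set} (xs : List A) {y ys} → length (xs ++ y ∷ ys) ≡ suc (length (xs ++ ys))
length-++-∷ [] = refl
length-++-∷ (x ∷ xs) = cong suc (length-++-∷ xs)

applyUpTo-++ : ∀ {A : Set} (f : ℕ → A) m n →
  applyUpTo f (m + n) ≡ applyUpTo f m ++ applyUpTo (λ i → f (m + i)) n
applyUpTo-++ f zero n = refl
applyUpTo-++ f (suc m) n = cong (f 0 ∷_) (applyUpTo-++ (f ∘ suc) m n)

after-common-prefix : ∀ {A : Set} (zs : List A) {x y : A} {xs ys} → zs ++ x ∷ xs ≡ zs ++ y ∷ ys → x ≡ y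
after-common-prefix zs eq = ∷-injectiveˡ (++-cancelˡ zs _ _ eq)

offset< : ∀ {m n i} → m ≤ n → i < n ∸ m → m + i < n
offset< {m} {n} {i} m≤n i<n∸m =
  subst₂ _≤_ (ℕₚ.+-suc m i) (ℕₚ.m+[n∸m]≡n m≤n) (ℕₚ.+-monoʳ-≤ m i<n∸m)

sumℤ-++ : ∀ xs ys → sumℤ (xs ++ ys) ≡ sumℤ xs +ℤ sumℤ ys
sumℤ-++ [] ys = sym (ℤₚ.+-identityˡ _)
sumℤ-++ (x ∷ xs) ys = trans (cong (x +ℤ_) (sumℤ-++ xs ys)) (sym (ℤₚ.+-assoc x _ _))

sumℤ-reverse : ∀ xs → sumℤ (reverse xs) ≡ sumℤ xs
sumℤ-reverse [] = refl
sumℤ-reverse (x ∷ xs) = begin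
  sumℤ (reverse (x ∷ xs))        ≡⟨ cong sumℤ (unfold-reverse x xs) ⟩
  sumℤ (reverse xs ++ x ∷ [])    ≡⟨ sumℤ-++ (reverse xs) (x ∷ []) ⟩
  sumℤ (reverse xs) +ℤ (x +ℤ + 0) ≡⟨ cong₂ _+ℤ_ (sumℤ-reverse xs) (ℤₚ.+-identityʳ x) ⟩
  sumℤ xs +ℤ x                   ≡⟨ ℤₚ.+-comm (sumℤ xs) x ⟩
  x +ℤ sumℤ xs                   ∎

sublist-complement : ∀ {xs ys : List ℤ} → xs ⊆ ys →
  Σ (List ℤ) λ zs → zs ⊆ ys × length zs + length xs ≡ length ys × sumℤ zs +ℤ sumℤ xs ≡ sumℤ ys
sublist-complement [] = [] , [] , refl , refl
sublist-complement (y ∷ʳ xs⊆ys) with sublist-complement xs⊆ys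
... | zs , zs⊆ys , len , sum =
  y ∷ zs , refl ∷ zs⊆ys , cong suc len , trans (ℤₚ.+-assoc y _ _) (cong (y +ℤ_) sum)
sublist-complement {y ∷ xs} {.y ∷ ys} (refl ∷ xs⊆ys) with sublist-complement xs⊆ys
... | zs , zs⊆ys , len , sum = zs , y ∷ʳ zs⊆ys , trans (ℕₚ.+-suc _ _) (cong suc len) , sum′
  where
  open ℤ-Solver.+-*-Solver
  sum′ : sumℤ zs +ℤ (y +ℤ sumℤ xs) ≡ y +ℤ sumℤ ys
  sum′ = trans (solve 3 (λ z y x → z :+ (y :+ x) := y :+ (z :+ x)) refl (sumℤ zs) y (sumℤ xs))
    (cong (y +ℤ_) sum)

complement∈Σ : ∀ {α β} {xs E : List ℤ} → xs ⊆ E → length xs ≤ β → α + β ≡ length E →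
  InSigma α E (sumℤ E -ℤ sumℤ xs)
complement∈Σ {α} {β} {xs} xs⊆E xs≤β α+β≡E with sublist-complement xs⊆E
... | zs , zs⊆E , len , sum = zs , zs⊆E , α≤zs , x≈z//y (sumℤ zs) (sumℤ xs) _ sum
  where
  α≤zs : α ≤ length zs
  α≤zs = ℕₚ.+-cancelʳ-≤ β α (length zs)
    (subst (_≤ length zs + β) (trans len (sym α+β≡E)) (ℕₚ.+-monoʳ-≤ (length zs) xs≤β))

distinct-pair⊆ : ∀ {A : Set} {x y : A} {xs} → x ∈ xs → y ∈ xs → x ≢ y →
  (x ∷ y ∷ []) ⊆ xs ⊎ (y ∷ x ∷ []) ⊆ xs
distinct-pair⊆ (here refl) (here refl) x≢y = ⊥-elim (x≢y refl)
distinct-pair⊆ (here refl) (there y∈) _ = inj₁ (refl ∷ from∈ y∈)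
distinct-pair⊆ (there x∈) (here refl) _ = inj₂ (refl ∷ from∈ x∈)
distinct-pair⊆ {xs = z ∷ _} (there x∈) (there y∈) x≢y with distinct-pair⊆ x∈ y∈ x≢y
... | inj₁ p = inj₁ (z ∷ʳ p)
... | inj₂ p = inj₂ (z ∷ʳ p)

-- Increasing enumerations

Unique-⊆ₛ⇒length≤ : ∀ {A : Set} {xs ys : List A} → Unique xs → xs ⊆ₛ ys → length xs ≤ length ys
Unique-⊆ₛ⇒length≤ [] _ = z≤n
Unique-⊆ₛ⇒length≤ {xs = x ∷ xs} (x∉xs ∷ u) xs⊆ys with ∈-∃++ (xs⊆ys (here refl))
... | ys₁ , ys₂ , refl = subst (suc (length xs) ≤_) (sym (length-++-∷ ys₁))
  (s≤s (Unique-⊆ₛ⇒length≤ u λ z∈xs →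
    ∈-remove ys₁ (xs⊆ys (there z∈xs)) λ z≡x → All.lookup x∉xs z∈xs (sym z≡x)))

Unique-⊆ₛ-length≥⇒⊇ₛ : ∀ {xs ys : List ℤ} → Unique xs → xs ⊆ₛ ys → length ys ≤ length xs →
  ys ⊆ₛ xs
Unique-⊆ₛ-length≥⇒⊇ₛ {xs} u xs⊆ys ys≤xs {x} x∈ys with x ∈? xs
... | yes x∈xs = x∈xs
... | no x∉xs = ⊥-elim (ℕₚ.<-irrefl refl (ℕₚ.≤-trans
  (Unique-⊆ₛ⇒length≤ (Allₚ.¬Any⇒All¬ xs x∉xs ∷ u) λ { (here refl) → x∈ys ; (there p) → xs⊆ys p })
  ys≤xs))

Increasing : List ℤ → Set
Increasing = AllPairs _<ℤ_

Increasing⇒Unique : ∀ {xs} → Increasing xs → Unique xs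
Increasing⇒Unique = AllPairs.map λ x<y x≡y → ℤₚ.<-irrefl x≡y x<y

Increasing-++ : ∀ c {xs ys} → Increasing xs → Increasing ys →
  All (_≤ℤ c) xs → All (c <ℤ_) ys → Increasing (xs ++ ys)
Increasing-++ c ixs iys xs≤c c<ys =
  AllPairsₚ.++⁺ ixs iys (All.map (λ x≤c → All.map (ℤₚ.≤-<-trans x≤c) c<ys) xs≤c)

Increasing-map-+ : ∀ c {xs} → Increasing xs → Increasing (map (c +ℤ_) xs)
Increasing-map-+ c ixs = AllPairsₚ.map⁺ (AllPairs.map (ℤₚ.+-monoʳ-< c) ixs)

map-+-above : ∀ c {xs} → All (+ 0 <ℤ_) xs → All (c <ℤ_) (map (c +ℤ_) xs)
map-+-above c = Allₚ.map⁺ ∘ All.map λ {x} 0<x →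
  subst (_<ℤ c +ℤ x) (ℤₚ.+-identityʳ c) (ℤₚ.+-monoʳ-< c 0<x)

AllPairs-++⁻ʳ : ∀ {A : Set} {R : A → A → Set} xs {ys} → AllPairs R (xs ++ ys) → AllPairs R ys
AllPairs-++⁻ʳ [] rs = rs
AllPairs-++⁻ʳ (x ∷ xs) (_ ∷ rs) = AllPairs-++⁻ʳ xs rs

Increasing-⊆ₛ-antisym : ∀ {xs ys} → Increasing xs → Increasing ys → xs ⊆ₛ ys → ys ⊆ₛ xs → xs ≡ ys
Increasing-⊆ₛ-antisym [] [] _ _ = refl
Increasing-⊆ₛ-antisym [] (_ ∷ _) _ ys⊆xs with ys⊆xs (here refl)
... | ()
Increasing-⊆ₛ-antisym (_ ∷ _) [] xs⊆ys _ with xs⊆ys (here refl)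
... | ()
Increasing-⊆ₛ-antisym {x ∷ xs} {y ∷ ys} (x<xs ∷ ixs) (y<ys ∷ iys) xs⊆ys ys⊆xs =
  cong₂ _∷_ x≡y (Increasing-⊆ₛ-antisym ixs iys tail⊆ tail⊇)
  where
  x≡y : x ≡ y
  x≡y with xs⊆ys (here refl) | ys⊆xs (here refl)
  ... | here x≡y | _ = x≡y
  ... | there x∈ys | here y≡x = sym y≡x
  ... | there x∈ys | there y∈xs = ⊥-elim (ℤₚ.<-asym (All.lookup y<ys x∈ys) (All.lookup x<xs y∈xs))
  tail⊆ : xs ⊆ₛ ys
  tail⊆ z∈xs with xs⊆ys (there z∈xs)
  ... | here z≡y = ⊥-elim (ℤₚ.<-irrefl (trans x≡y (sym z≡y)) (All.lookup x<xs z∈xs))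
  ... | there z∈ys = z∈ys
  tail⊇ : ys ⊆ₛ xs
  tail⊇ z∈ys with ys⊆xs (there z∈ys)
  ... | here z≡x = ⊥-elim (ℤₚ.<-irrefl (trans (sym x≡y) (sym z≡x)) (All.lookup y<ys z∈ys))
  ... | there z∈xs = z∈xs

increasing-enumeration-unique : (P : ℤ → Set) {L : List ℤ} → (∀ {x} → P x → x ∈ L) →
  ∀ {xs ys} → Increasing xs → Increasing ys → All P xs → All P ys →
  length L ≤ length xs → length L ≤ length ys → xs ≡ ys
increasing-enumeration-unique P cover ixs iys Pxs Pys L≤xs L≤ys = Increasing-⊆ₛ-antisym ixs iys
  (λ x∈xs → Unique-⊆ₛ-length≥⇒⊇ₛ (Increasing⇒Unique iys) (cover ∘ All.lookup Pys) L≤ys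
    (cover (All.lookup Pxs x∈xs)))
  (λ y∈ys → Unique-⊆ₛ-length≥⇒⊇ₛ (Increasing⇒Unique ixs) (cover ∘ All.lookup Pxs) L≤xs
    (cover (All.lookup Pys y∈ys)))

-- Sums of at most β values

SuffixesDownClosed : List ℕ → Set
SuffixesDownClosed [] = ⊤
SuffixesDownClosed (t ∷ ts) = (∀ {s} → s ≤ t → s ∈ t ∷ ts) × SuffixesDownClosed ts

module _ (B : ℕ → ℤ) where

  vals : ℕ → List ℤ
  vals t = applyUpTo (B ∘ suc) t

  Sums : List ℕ → ℕ → ℤ → Set
  Sums ds β x = Σ (List ℕ) λ R → R ⊆ ds × length R ≤ β × sumℤ (map B R) ≡ x

  Sums-empty : ∀ ds β → Sums ds β (+ 0)
  Sums-empty ds β = [] , minimum ds , z≤n , refl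

  Sums-singleton : ∀ {ds β t} → t ∈ ds → 1 ≤ β → Sums ds β (B t)
  Sums-singleton t∈ds 1≤β = _ ∷ [] , from∈ t∈ds , 1≤β , ℤₚ.+-identityʳ _

  Sums-pair : ∀ {ds β s t} → s ∈ ds → t ∈ ds → s ≢ t → 2 ≤ β → Sums ds β (B s +ℤ B t)
  Sums-pair {s = s} {t} s∈ds t∈ds s≢t 2≤β with distinct-pair⊆ s∈ds t∈ds s≢t
  ... | inj₁ st⊆ds = _ , st⊆ds , 2≤β , cong (B s +ℤ_) (ℤₚ.+-identityʳ (B t))
  ... | inj₂ ts⊆ds = _ , ts⊆ds , 2≤β ,
    trans (cong (B t +ℤ_) (ℤₚ.+-identityʳ (B s))) (ℤₚ.+-comm (B t) (B s))

  chain : List ℕ → ℕ → List ℤ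
  chain [] β = []
  chain (t ∷ ts) zero = []
  chain (t ∷ ts) (suc β) = vals t ++ map (B t +ℤ_) (chain ts β)

  chain-length : ∀ ds β → length (chain ds β) ≡ sumℕ (take β ds)
  chain-length [] zero = refl
  chain-length [] (suc β) = refl
  chain-length (t ∷ ts) zero = refl
  chain-length (t ∷ ts) (suc β) = begin
    length (vals t ++ map (B t +ℤ_) (chain ts β))        ≡⟨ length-++ (vals t) ⟩
    length (vals t) + length (map (B t +ℤ_) (chain ts β)) ≡⟨ cong₂ _+_ (length-applyUpTo _ t)
                                                              (length-map _ (chain ts β)) ⟩
    t + length (chain ts β)                              ≡⟨ cong (_+_ t) (chain-length ts β) ⟩
    t + sumℕ (take β ts)                                 ∎

  chain-sums : ∀ ds β → SuffixesDownClosed ds → All (Sums ds β) (chain ds β)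
  chain-sums [] β _ = []
  chain-sums (t ∷ ts) zero _ = []
  chain-sums (t ∷ ts) (suc β) (closed , ts-closed) =
    Allₚ.++⁺ (Allₚ.applyUpTo⁺₁ _ t λ i<t → Sums-singleton (closed i<t) (s≤s z≤n))
             (Allₚ.map⁺ (All.map prepend (chain-sums ts β ts-closed)))
    where
    prepend : ∀ {y} → Sums ts β y → Sums (t ∷ ts) (suc β) (B t +ℤ y)
    prepend (R , R⊆ts , R≤β , ΣR) = t ∷ R , refl ∷ R⊆ts , s≤s R≤β , cong (B t +ℤ_) ΣR

module Monotone (K : ℕ) (B : ℕ → ℤ) (B-zero : B 0 ≡ + 0)
  (B-mono : ∀ {s t} → s < t → t ≤ K → B s <ℤ B t) where

  B-mono-≤ : ∀ {s t} → s ≤ t → t ≤ K → B s ≤ℤ B t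
  B-mono-≤ s≤t t≤K with ℕₚ.m≤n⇒m<n∨m≡n s≤t
  ... | inj₁ s<t = ℤₚ.<⇒≤ (B-mono s<t t≤K)
  ... | inj₂ refl = ℤₚ.≤-refl

  B-positive : ∀ {t} → 0 < t → t ≤ K → + 0 <ℤ B t
  B-positive 0<t t≤K = subst (_<ℤ B _) B-zero (B-mono 0<t t≤K)

  B-nonneg : ∀ {t} → t ≤ K → + 0 ≤ℤ B t
  B-nonneg t≤K = subst (_≤ℤ B _) B-zero (B-mono-≤ z≤n t≤K)

  vals-increasing : ∀ {t} → t ≤ K → Increasing (vals B t)
  vals-increasing t≤K = AllPairsₚ.applyUpTo⁺₁ _ _ λ i<j j<t → B-mono (s≤s i<j) (ℕₚ.≤-trans j<t t≤K)

  vals-positive : ∀ {t} → t ≤ K → All (+ 0 <ℤ_) (vals B t)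
  vals-positive t≤K = Allₚ.applyUpTo⁺₁ _ _ λ i<t → B-positive (s≤s z≤n) (ℕₚ.≤-trans i<t t≤K)

  vals-≤ : ∀ {t} → t ≤ K → All (_≤ℤ B t) (vals B t)
  vals-≤ t≤K = Allₚ.applyUpTo⁺₁ _ _ λ i<t → B-mono-≤ i<t t≤K

  chain-increasing : ∀ ds β → All (_≤ K) ds →
    Increasing (chain B ds β) × All (+ 0 <ℤ_) (chain B ds β)
  chain-increasing [] β _ = [] , []
  chain-increasing (t ∷ ts) zero _ = [] , []
  chain-increasing (t ∷ ts) (suc β) (t≤K ∷ ts≤K) with chain-increasing ts β ts≤K
  ... | inc , pos =
    Increasing-++ (B t) (vals-increasing t≤K) (Increasing-map-+ (B t) inc) (vals-≤ t≤K) (map-+-above (B t) pos) ,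
    Allₚ.++⁺ (vals-positive t≤K) (All.map (ℤₚ.≤-<-trans (B-nonneg t≤K)) (map-+-above (B t) pos))

tabulate-suc : ∀ {k} → tabulate F.suc ≡ map F.suc (allFin k)
tabulate-suc = sym (map-tabulate (λ i → i) F.suc)

totalSum-suc : ∀ {k} (f : Fin (suc k) → ℕ) → totalSum f ≡ f F.zero + totalSum (f ∘ F.suc)
totalSum-suc {k} f = cong (λ xs → f F.zero + sumℕ xs) (begin
  map f (tabulate F.suc)          ≡⟨ cong (map f) tabulate-suc ⟩
  map f (map F.suc (allFin k))    ≡⟨ sym (map-∘ (allFin k)) ⟩
  map (f ∘ F.suc) (allFin k)      ∎)

prefixSum-suc : ∀ {k} j (f : Fin (suc k) → ℕ) → prefixSum (suc j) f ≡ f F.zero + prefixSum j (f ∘ F.suc)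
prefixSum-suc {k} j f = cong (λ xs → f F.zero + sumℕ xs) (begin
  map f (take j (tabulate F.suc))          ≡⟨ cong (map f ∘ take j) tabulate-suc ⟩
  map f (take j (map F.suc (allFin k)))    ≡⟨ cong (map f) (take-map j (allFin k)) ⟩
  map f (map F.suc (take j (allFin k)))    ≡⟨ sym (map-∘ (take j (allFin k))) ⟩
  map (f ∘ F.suc) (take j (allFin k))      ∎)

prefixSum≤totalSum : ∀ {k} j (f : Fin k → ℕ) → prefixSum j f ≤ totalSum f
prefixSum≤totalSum {k} j f = subst (_≤ totalSum f) (cong sumℕ (take-map j (allFin k)))
  (sum-take-≤ j (map f (allFin k)))

weighted : ∀ {k} → (Fin k → ℕ) → Fin k → ℕ
weighted r i = toℕ i * r i

totalSum-weighted-suc : ∀ {k} (r : Fin (suc k) → ℕ) →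
  totalSum (weighted r) ≡ totalSum (r ∘ F.suc) + totalSum (weighted (r ∘ F.suc))
totalSum-weighted-suc {k} r =
  trans (totalSum-suc (weighted r)) (sum-map-+ (r ∘ F.suc) (weighted (r ∘ F.suc)) (allFin k))

prefixSum-weighted-suc : ∀ {k} j (r : Fin (suc k) → ℕ) →
  prefixSum (suc j) (weighted r) ≡ prefixSum j (r ∘ F.suc) + prefixSum j (weighted (r ∘ F.suc))
prefixSum-weighted-suc {k} j r =
  trans (prefixSum-suc j (weighted r)) (sum-map-+ (r ∘ F.suc) (weighted (r ∘ F.suc)) (take j (allFin k)))

-- The index sequence

extend : ∀ {A : Set} → A → ∀ {k} → (Fin k → A) → ℕ → A
extend d {zero} f t = d
extend d {suc k} f zero = f F.zero
extend d {suc k} f (suc t) = extend d (f ∘ F.suc) t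

extend-toℕ : ∀ {A : Set} (d : A) {k} (f : Fin k → A) i → extend d f (toℕ i) ≡ f i
extend-toℕ d f F.zero = refl
extend-toℕ d f (F.suc i) = extend-toℕ d (f ∘ F.suc) i

extend-strictMono : ∀ {K} (a : Fin (suc K) → ℤ) → (∀ i j → i F.< j → a i <ℤ a j) →
  ∀ {s t} → s < t → t ≤ K → extend (+ 0) a s <ℤ extend (+ 0) a t
extend-strictMono {K} a a-mono {s} {t} s<t t≤K = subst₂ _<ℤ_ (at s<k) (at t<k)
  (a-mono _ _ (subst₂ _<_ (sym (toℕ-fromℕ< s<k)) (sym (toℕ-fromℕ< t<k)) s<t))
  where
  t<k : t < suc K
  t<k = s≤s t≤K
  s<k : s < suc K
  s<k = ℕₚ.<-trans s<t t<k
  at : ∀ {u} (u<k : u < suc K) → a (F.fromℕ< u<k) ≡ extend (+ 0) a u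
  at u<k = trans (sym (extend-toℕ (+ 0) a _)) (cong (extend (+ 0) a) (toℕ-fromℕ< u<k))

indices↓ : ∀ k → (Fin k → ℕ) → List ℕ
indices↓ zero r = []
indices↓ (suc k) r = map suc (indices↓ k (r ∘ F.suc)) ++ replicate (r F.zero) 0

expand-suc : ∀ {k} (r : Fin (suc k) → ℕ) (a : Fin (suc k) → ℤ) →
  expand r a ≡ replicate (r F.zero) (a F.zero) ++ expand (r ∘ F.suc) (a ∘ F.suc)
expand-suc {k} r a = cong (λ xs → replicate (r F.zero) (a F.zero) ++ concat xs) (begin
  map (λ i → replicate (r i) (a i)) (tabulate F.suc)         ≡⟨ cong (map _) tabulate-suc ⟩
  map (λ i → replicate (r i) (a i)) (map F.suc (allFin k))   ≡⟨ sym (map-∘ (allFin k)) ⟩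
  map (λ i → replicate (r (F.suc i)) (a (F.suc i))) (allFin k) ∎)

expand-indices↓ : ∀ k (r : Fin k → ℕ) a → expand r a ≡ reverse (map (extend (+ 0) a) (indices↓ k r))
expand-indices↓ zero r a = refl
expand-indices↓ (suc k) r a = begin
  expand r a
    ≡⟨ expand-suc r a ⟩
  replicate (r F.zero) (a F.zero) ++ expand (r ∘ F.suc) (a ∘ F.suc)
    ≡⟨ cong₂ _++_ (sym zeros) (expand-indices↓ k (r ∘ F.suc) (a ∘ F.suc)) ⟩
  reverse (map B (replicate (r F.zero) 0)) ++ reverse (map (B ∘ suc) D)
    ≡⟨ sym (reverse-++ (map (B ∘ suc) D) _) ⟩
  reverse (map (B ∘ suc) D ++ map B (replicate (r F.zero) 0))
    ≡⟨ cong (λ xs → reverse (xs ++ map B (replicate (r F.zero) 0))) (map-∘ D) ⟩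
  reverse (map B (map suc D) ++ map B (replicate (r F.zero) 0))
    ≡⟨ cong reverse (sym (map-++ B (map suc D) _)) ⟩
  reverse (map B (indices↓ (suc k) r))
    ∎
  where
  B : ℕ → ℤ
  B = extend (+ 0) a
  D : List ℕ
  D = indices↓ k (r ∘ F.suc)
  zeros : reverse (map B (replicate (r F.zero) 0)) ≡ replicate (r F.zero) (a F.zero)
  zeros = trans (cong reverse (map-replicate B (r F.zero) 0)) (reverse-replicate (r F.zero) (a F.zero))

length-indices↓ : ∀ k (r : Fin k → ℕ) → length (indices↓ k r) ≡ totalSum r
length-indices↓ zero r = refl
length-indices↓ (suc k) r = begin
  length (map suc D ++ replicate (r F.zero) 0)
    ≡⟨ length-++ (map suc D) ⟩
  length (map suc D) + length (replicate (r F.zero) 0)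
    ≡⟨ cong₂ _+_ (trans (length-map suc D) (length-indices↓ k (r ∘ F.suc))) (length-replicate (r F.zero)) ⟩
  totalSum (r ∘ F.suc) + r F.zero
    ≡⟨ ℕₚ.+-comm (totalSum (r ∘ F.suc)) _ ⟩
  r F.zero + totalSum (r ∘ F.suc)
    ≡⟨ sym (totalSum-suc r) ⟩
  totalSum r
    ∎
  where
  D : List ℕ
  D = indices↓ k (r ∘ F.suc)

sum-indices↓ : ∀ k (r : Fin k → ℕ) → sumℕ (indices↓ k r) ≡ totalSum (weighted r)
sum-indices↓ zero r = refl
sum-indices↓ (suc k) r = begin
  sumℕ (map suc D ++ replicate (r F.zero) 0)
    ≡⟨ sum-++ (map suc D) _ ⟩
  sumℕ (map suc D) + sumℕ (replicate (r F.zero) 0)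
    ≡⟨ cong₂ _+_ (sum-map-suc D) (sum-replicate-0 (r F.zero)) ⟩
  length D + sumℕ D + 0
    ≡⟨ ℕₚ.+-identityʳ _ ⟩
  length D + sumℕ D
    ≡⟨ cong₂ _+_ (length-indices↓ k (r ∘ F.suc)) (sum-indices↓ k (r ∘ F.suc)) ⟩
  totalSum (r ∘ F.suc) + totalSum (weighted (r ∘ F.suc))
    ≡⟨ sym (totalSum-weighted-suc r) ⟩
  totalSum (weighted r)
    ∎
  where
  D : List ℕ
  D = indices↓ k (r ∘ F.suc)

indices↓-bounded : ∀ k (r : Fin k → ℕ) → All (_< k) (indices↓ k r)
indices↓-bounded zero r = []
indices↓-bounded (suc k) r =
  Allₚ.++⁺ (Allₚ.map⁺ (All.map s≤s (indices↓-bounded k (r ∘ F.suc))))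
           (Allₚ.replicate⁺ (r F.zero) (s≤s z≤n))

SuffixesDownClosed-map-suc-++ : ∀ ds {zs} → SuffixesDownClosed ds → 0 ∈ zs → SuffixesDownClosed zs →
  SuffixesDownClosed (map suc ds ++ zs)
SuffixesDownClosed-map-suc-++ [] _ _ zs-closed = zs-closed
SuffixesDownClosed-map-suc-++ (t ∷ ds) {zs} (closed , ds-closed) 0∈zs zs-closed =
  closed′ , SuffixesDownClosed-map-suc-++ ds ds-closed 0∈zs zs-closed
  where
  closed′ : ∀ {s} → s ≤ suc t → s ∈ suc t ∷ map suc ds ++ zs
  closed′ {zero} _ = there (∈-++⁺ʳ (map suc ds) 0∈zs)
  closed′ {suc s} (s≤s s≤t) = ∈-++⁺ˡ (∈-map⁺ suc (closed s≤t))

SuffixesDownClosed-replicate-0 : ∀ n → SuffixesDownClosed (replicate n 0)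
SuffixesDownClosed-replicate-0 zero = tt
SuffixesDownClosed-replicate-0 (suc n) = (λ { z≤n → here refl }) , SuffixesDownClosed-replicate-0 n

indices↓-closed : ∀ k (r : Fin k → ℕ) → (∀ i → 1 ≤ r i) → SuffixesDownClosed (indices↓ k r)
indices↓-closed zero r _ = tt
indices↓-closed (suc k) r r-pos =
  SuffixesDownClosed-map-suc-++ (indices↓ k (r ∘ F.suc)) (indices↓-closed k (r ∘ F.suc) (r-pos ∘ F.suc))
    (0∈zeros (r-pos F.zero)) (SuffixesDownClosed-replicate-0 (r F.zero))
  where
  0∈zeros : ∀ {n} → 1 ≤ n → 0 ∈ replicate n 0
  0∈zeros (s≤s _) = here refl

indices↓-top-two : ∀ K′ (r : Fin (2 + K′) → ℕ) → (∀ i → 1 ≤ r i) →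
  Σ ℕ λ u → Σ (List ℕ) λ rest → indices↓ (2 + K′) r ≡ suc K′ ∷ u ∷ rest × K′ ≤ u
indices↓-top-two zero r r-pos = second (r-pos (F.suc F.zero)) (r-pos F.zero)
  where
  second : ∀ {m n} → 1 ≤ m → 1 ≤ n →
    Σ ℕ λ u → Σ (List ℕ) λ rest → map suc (replicate m 0) ++ replicate n 0 ≡ 1 ∷ u ∷ rest × 0 ≤ u
  second {suc zero} {suc n} _ _ = 0 , replicate n 0 , refl , z≤n
  second {suc (suc m)} {n} _ _ = 1 , map suc (replicate m 0) ++ replicate n 0 , refl , z≤n
indices↓-top-two (suc K′) r r-pos with indices↓-top-two K′ (r ∘ F.suc) (r-pos ∘ F.suc)
... | u , rest , top , K′≤u =
  suc u , map suc rest ++ replicate (r F.zero) 0 , cong (λ ds → map suc ds ++ replicate (r F.zero) 0) top , s≤s K′≤u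

-- The β largest indices consist of all indices above j together with δ copies of j.
sum-largest : ∀ k (r : Fin k → ℕ) j β δ → j < k →
  prefixSum j r + δ ≤ prefixSum (suc j) r → β + prefixSum (suc j) r ≡ totalSum r + δ →
  sumℕ (take β (indices↓ k r)) + prefixSum (suc j) (weighted r) ≡ totalSum (weighted r) + j * δ
sum-largest (suc k) r zero β δ _ _ β≡ = begin
  sumℕ (take β (map suc D ++ zeros)) + 0
    ≡⟨ ℕₚ.+-identityʳ _ ⟩
  sumℕ (take β (map suc D ++ zeros))
    ≡⟨ cong (λ b → sumℕ (take b (map suc D ++ zeros))) β≡D+δ ⟩
  sumℕ (take (length (map suc D) + δ) (map suc D ++ zeros))
    ≡⟨ cong sumℕ (take-++-length (map suc D) δ) ⟩
  sumℕ (map suc D ++ take δ zeros)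
    ≡⟨ sum-++ (map suc D) _ ⟩
  sumℕ (map suc D) + sumℕ (take δ zeros)
    ≡⟨ cong (_+_ (sumℕ (map suc D))) (trans (sum-take-replicate-0 δ (r F.zero)) (sym (sum-replicate-0 (r F.zero)))) ⟩
  sumℕ (map suc D) + sumℕ zeros
    ≡⟨ sym (sum-++ (map suc D) zeros) ⟩
  sumℕ (indices↓ (suc k) r)
    ≡⟨ sum-indices↓ (suc k) r ⟩
  totalSum (weighted r)
    ≡⟨ sym (ℕₚ.+-identityʳ _) ⟩
  totalSum (weighted r) + 0
    ∎
  where
  open ℕ-Solver.+-*-Solver
  D zeros : List ℕ
  D = indices↓ k (r ∘ F.suc)
  zeros = replicate (r F.zero) 0
  β≡D+δ : β ≡ length (map suc D) + δ
  β≡D+δ = ℕₚ.+-cancelʳ-≡ (r F.zero) β _ (begin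
    β + r F.zero                         ≡⟨ cong (_+_ β) (sym (ℕₚ.+-identityʳ (r F.zero))) ⟩
    β + prefixSum 1 r                    ≡⟨ β≡ ⟩
    totalSum r + δ                       ≡⟨ cong (_+ δ) (totalSum-suc r) ⟩
    r F.zero + totalSum (r ∘ F.suc) + δ  ≡⟨ cong (λ n → r F.zero + n + δ) (sym length-D) ⟩
    r F.zero + length (map suc D) + δ    ≡⟨ solve 3 (λ a b c → a :+ b :+ c := b :+ c :+ a) refl (r F.zero) _ δ ⟩
    length (map suc D) + δ + r F.zero    ∎)
    where
    length-D : length (map suc D) ≡ totalSum (r ∘ F.suc)
    length-D = trans (length-map suc D) (length-indices↓ k (r ∘ F.suc))
sum-largest (suc k) r (suc j) β δ (s≤s j<k) δ≤ β≡ = begin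
  sumℕ (take β (map suc D ++ replicate (r F.zero) 0)) + prefixSum (2 + j) (weighted r)
    ≡⟨ cong₂ _+_ (sum-take-map-suc D β≤D) (prefixSum-weighted-suc (suc j) r) ⟩
  β + sumℕ (take β D) + (P + PW)
    ≡⟨ solve 4 (λ b s p w → b :+ s :+ (p :+ w) := s :+ w :+ (b :+ p)) refl β (sumℕ (take β D)) P PW ⟩
  sumℕ (take β D) + PW + (β + P)
    ≡⟨ cong₂ _+_ (sum-largest k (r ∘ F.suc) j β δ j<k δ≤′ β≡′) β≡′ ⟩
  TW + j * δ + (T + δ)
    ≡⟨ solve 4 (λ w jd t d → w :+ jd :+ (t :+ d) := t :+ w :+ (d :+ jd)) refl TW (j * δ) T δ ⟩
  T + TW + suc j * δ
    ≡⟨ cong (_+ suc j * δ) (sym (totalSum-weighted-suc r)) ⟩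
  totalSum (weighted r) + suc j * δ
    ∎
  where
  open ℕ-Solver.+-*-Solver
  D : List ℕ
  D = indices↓ k (r ∘ F.suc)
  P PW T TW : ℕ
  P = prefixSum (suc j) (r ∘ F.suc)
  PW = prefixSum (suc j) (weighted (r ∘ F.suc))
  T = totalSum (r ∘ F.suc)
  TW = totalSum (weighted (r ∘ F.suc))
  δ≤′ : prefixSum j (r ∘ F.suc) + δ ≤ P
  δ≤′ = ℕₚ.+-cancelˡ-≤ (r F.zero) _ _ (subst₂ _≤_
    (trans (cong (_+ δ) (prefixSum-suc j r)) (ℕₚ.+-assoc (r F.zero) _ δ)) (prefixSum-suc (suc j) r) δ≤)
  β≡′ : β + P ≡ T + δ
  β≡′ = ℕₚ.+-cancelˡ-≡ (r F.zero) _ _ (begin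
    r F.zero + (β + P)    ≡⟨ solve 3 (λ a b p → a :+ (b :+ p) := b :+ (a :+ p)) refl (r F.zero) β P ⟩
    β + (r F.zero + P)    ≡⟨ cong (_+_ β) (sym (prefixSum-suc (suc j) r)) ⟩
    β + prefixSum (2 + j) r ≡⟨ β≡ ⟩
    totalSum r + δ        ≡⟨ cong (_+ δ) (totalSum-suc r) ⟩
    r F.zero + T + δ      ≡⟨ ℕₚ.+-assoc (r F.zero) T δ ⟩
    r F.zero + (T + δ)    ∎)
  β≤D : β ≤ length D
  β≤D = ℕₚ.+-cancelʳ-≤ P β (length D) (subst₂ _≤_ (sym β≡′)
    (cong (_+ P) (sym (length-indices↓ k (r ∘ F.suc))))
    (ℕₚ.+-monoʳ-≤ T (ℕₚ.≤-trans (ℕₚ.m≤n+m δ _) δ≤′)))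

-- Rigidity

module Rigidity (K₀ : ℕ) (B : ℕ → ℤ) (B-zero : B 0 ≡ + 0)
  (B-mono : ∀ {s t} → s < t → t ≤ 4 + K₀ → B s <ℤ B t) where

  K K′ : ℕ
  K = 4 + K₀
  K′ = 3 + K₀

  open Monotone K B B-zero B-mono

  V : ℤ
  V = B K +ℤ B K′

  single-≤V : ∀ {t} → t ≤ K → B t ≤ℤ V
  single-≤V {t} t≤K = subst (_≤ℤ V) (ℤₚ.+-identityʳ (B t))
    (ℤₚ.+-mono-≤ (B-mono-≤ t≤K ℕₚ.≤-refl) (B-nonneg (ℕₚ.n≤1+n K′)))

  pair-≤V : ∀ {x y} → x ≤ K′ → y ≤ K → B x +ℤ B y ≤ℤ V
  pair-≤V x≤K′ y≤K = subst (_ ≤ℤ_) (ℤₚ.+-comm (B K′) (B K))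
    (ℤₚ.+-mono-≤ (B-mono-≤ x≤K′ (ℕₚ.n≤1+n K′)) (B-mono-≤ y≤K ℕₚ.≤-refl))

  lower : ∀ {c c′ xs} → c′ ≤ℤ c → All (c <ℤ_) xs → All (c′ <ℤ_) xs
  lower c′≤c = All.map (ℤₚ.≤-<-trans c′≤c)

  -- `small` says that D has no more elements than 0 ∷ chain, which therefore
  -- enumerates D.
  module _ (u : ℕ) (rest : List ℕ) (β₀ : ℕ) (K′≤u : K′ ≤ u)
    (bounded : All (_≤ K) (K ∷ u ∷ rest)) (closed : SuffixesDownClosed (K ∷ u ∷ rest))
    (L : List ℤ) (cover : ∀ {x} → Sums B (K ∷ u ∷ rest) (2 + β₀) x → x ∈ L)
    (small : length L ≤ suc (sumℕ (take (2 + β₀) (K ∷ u ∷ rest)))) where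

    ds : List ℕ
    ds = K ∷ u ∷ rest

    β : ℕ
    β = 2 + β₀

    D : ℤ → Set
    D = Sums B ds β

    u≤K : u ≤ K
    u≤K = All.head (All.tail bounded)

    rest≤K : All (_≤ K) rest
    rest≤K = All.tail (All.tail bounded)

    single : ∀ {t} → t ≤ K → D (B t)
    single t≤K = Sums-singleton B (proj₁ closed t≤K) (s≤s z≤n)

    pair : ∀ {s t} → s ≤ K → t ≤ K → s ≢ t → D (B s +ℤ B t)
    pair s≤K t≤K s≢t = Sums-pair B (proj₁ closed s≤K) (proj₁ closed t≤K) s≢t (s≤s (s≤s z≤n))

    enumeration : List ℤ
    enumeration = + 0 ∷ chain B ds β

    enumeration-increasing : Increasing enumeration
    enumeration-increasing with chain-increasing ds β bounded
    ... | inc , pos = pos ∷ inc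

    enumeration-sums : All D enumeration
    enumeration-sums = Sums-empty B ds β ∷ chain-sums B ds β closed

    vals-u-rest Y : List ℤ
    vals-u-rest = applyUpTo (λ i → B (suc (K′ + i))) (u ∸ K′)
    Y = map (B u +ℤ_) (chain B rest β₀)

    below above : List ℤ
    below = + 0 ∷ vals B K ++ map (B K +ℤ_) (vals B K′)
    above = map (B K +ℤ_) (vals-u-rest ++ Y)

    enumeration-split : enumeration ≡ below ++ above
    enumeration-split = cong (+ 0 ∷_) (begin
      vals B K ++ map (B K +ℤ_) (vals B u ++ Y)
        ≡⟨ cong (λ xs → vals B K ++ map (B K +ℤ_) (xs ++ Y)) vals-u ⟩
      vals B K ++ map (B K +ℤ_) ((vals B K′ ++ vals-u-rest) ++ Y)
        ≡⟨ cong (λ xs → vals B K ++ map (B K +ℤ_) xs) (++-assoc (vals B K′) vals-u-rest Y) ⟩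
      vals B K ++ map (B K +ℤ_) (vals B K′ ++ (vals-u-rest ++ Y))
        ≡⟨ cong (vals B K ++_) (map-++ (B K +ℤ_) (vals B K′) (vals-u-rest ++ Y)) ⟩
      vals B K ++ (map (B K +ℤ_) (vals B K′) ++ above)
        ≡⟨ sym (++-assoc (vals B K) _ above) ⟩
      (vals B K ++ map (B K +ℤ_) (vals B K′)) ++ above
        ∎)
      where
      vals-u : vals B u ≡ vals B K′ ++ vals-u-rest
      vals-u = trans (cong (vals B) (sym (ℕₚ.m+[n∸m]≡n K′≤u))) (applyUpTo-++ (B ∘ suc) K′ (u ∸ K′))

    above-V : All (V <ℤ_) above
    above-V = Allₚ.map⁺ (All.map (ℤₚ.+-monoʳ-< (B K)) (Allₚ.++⁺
      (Allₚ.applyUpTo⁺₁ _ _ λ i< → B-mono (s≤s (ℕₚ.m≤m+n K′ _)) (ℕₚ.≤-trans (offset< K′≤u i<) u≤K))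
      (lower (B-mono-≤ K′≤u u≤K) (map-+-above (B u) (proj₂ (chain-increasing rest β₀ rest≤K))))))

    below-V-unique : ∀ {P} → Increasing P → All D P → All (_≤ℤ V) P → length P ≡ length below → P ≡ below
    below-V-unique {P} P-inc P-sums P≤V P-length = ++-cancelʳ above P below
      (increasing-enumeration-unique D cover
        (Increasing-++ V P-inc (AllPairs-++⁻ʳ below split-increasing) P≤V above-V) split-increasing
        (Allₚ.++⁺ P-sums (Allₚ.++⁻ʳ below split-sums)) split-sums
        (subst (length L ≤_) length-P++above L≤enumeration)
        (subst (length L ≤_) (cong length enumeration-split) L≤enumeration))
      where
      split-increasing : Increasing (below ++ above)
      split-increasing = subst Increasing enumeration-split enumeration-increasing
      split-sums : All D (below ++ above)
      split-sums = subst (All D) enumeration-split enumeration-sums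
      L≤enumeration : length L ≤ length enumeration
      L≤enumeration = subst (λ n → length L ≤ suc n) (sym (chain-length B ds β)) small
      length-P++above : length enumeration ≡ length (P ++ above)
      length-P++above = begin
        length enumeration          ≡⟨ cong length enumeration-split ⟩
        length (below ++ above)     ≡⟨ length-++ below ⟩
        length below + length above ≡⟨ cong (_+ length above) (sym P-length) ⟩
        length P + length above     ≡⟨ sym (length-++ P) ⟩
        length (P ++ above)         ∎

    -- path w s lists 0, B₁ … B_s, then B_i + B_s (i ≤ w), B_w + B_t (s < t ≤ K)
    -- and B_K + B_i (w < i < K).
    seg₂ seg₃ : ℕ → ℕ → List ℤ
    seg₂ w s = applyUpTo (λ i → B (suc i) +ℤ B s) w
    seg₃ w s = applyUpTo (λ i → B w +ℤ B (suc (s + i))) (K ∸ s)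

    seg₄ : ℕ → List ℤ
    seg₄ w = applyUpTo (λ i → B K +ℤ B (suc (w + i))) (K′ ∸ w)

    path : ℕ → ℕ → List ℤ
    path w s = + 0 ∷ vals B s ++ seg₂ w s ++ seg₃ w s ++ seg₄ w

    module _ {w s : ℕ} (w<s : w < s) (s≤K : s ≤ K) where

      w≤K′ : w ≤ K′
      w≤K′ = ℕₚ.≤-pred (ℕₚ.≤-trans w<s s≤K)

      w≤K : w ≤ K
      w≤K = ℕₚ.≤-trans w≤K′ (ℕₚ.n≤1+n K′)

      s+i<K : ∀ {i} → i < K ∸ s → s + i < K
      s+i<K = offset< s≤K

      w+i<K : ∀ {i} → i < K′ ∸ w → suc (w + i) < K
      w+i<K i< = s≤s (offset< w≤K′ i<)

      path-sums : All D (path w s)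
      path-sums = Sums-empty B ds β ∷ Allₚ.++⁺
        (Allₚ.applyUpTo⁺₁ _ s λ i<s → single (ℕₚ.≤-trans i<s s≤K)) (Allₚ.++⁺
        (Allₚ.applyUpTo⁺₁ _ w λ i<w → pair (ℕₚ.≤-trans i<w w≤K) s≤K
          λ i≡s → ℕₚ.<-irrefl i≡s (ℕₚ.≤-<-trans i<w w<s)) (Allₚ.++⁺
        (Allₚ.applyUpTo⁺₁ _ (K ∸ s) λ {i} i< → pair w≤K (s+i<K i<)
          λ w≡t → ℕₚ.<-irrefl w≡t (ℕₚ.<-≤-trans w<s (ℕₚ.m≤n⇒m≤1+n (ℕₚ.m≤m+n s i))))
        (Allₚ.applyUpTo⁺₁ _ (K′ ∸ w) λ i< → pair ℕₚ.≤-refl (ℕₚ.<⇒≤ (w+i<K i<))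
          λ K≡t → ℕₚ.<-irrefl (sym K≡t) (w+i<K i<))))

      path-≤V : All (_≤ℤ V) (path w s)
      path-≤V = subst (_≤ℤ V) B-zero (single-≤V z≤n) ∷ Allₚ.++⁺
        (Allₚ.applyUpTo⁺₁ _ s λ i<s → single-≤V (ℕₚ.≤-trans i<s s≤K)) (Allₚ.++⁺
        (Allₚ.applyUpTo⁺₁ _ w λ i<w → pair-≤V (ℕₚ.≤-trans i<w w≤K′) s≤K) (Allₚ.++⁺
        (Allₚ.applyUpTo⁺₁ _ (K ∸ s) λ i< → pair-≤V w≤K′ (s+i<K i<))
        (Allₚ.applyUpTo⁺₁ _ (K′ ∸ w) λ i< → ℤₚ.+-monoʳ-≤ (B K) (B-mono-≤ (ℕₚ.≤-pred (w+i<K i<)) (ℕₚ.n≤1+n K′)))))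

      path-increasing : Increasing (path w s)
      path-increasing =
        Allₚ.++⁺ (vals-positive s≤K) (lower (B-nonneg s≤K) above-s) ∷
        Increasing-++ (B s) (vals-increasing s≤K) inc₂₃₄ (vals-≤ s≤K) above-s
        where
        inc₂ : Increasing (seg₂ w s)
        inc₂ = AllPairsₚ.applyUpTo⁺₁ _ w λ i<j j<w →
          ℤₚ.+-monoˡ-< (B s) (B-mono (s≤s i<j) (ℕₚ.≤-trans j<w w≤K))
        inc₃ : Increasing (seg₃ w s)
        inc₃ = AllPairsₚ.applyUpTo⁺₁ _ _ λ i<j j< →
          ℤₚ.+-monoʳ-< (B w) (B-mono (s≤s (ℕₚ.+-monoʳ-< s i<j)) (s+i<K j<))
        inc₄ : Increasing (seg₄ w)
        inc₄ = AllPairsₚ.applyUpTo⁺₁ _ _ λ i<j j< →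
          ℤₚ.+-monoʳ-< (B K) (B-mono (s≤s (ℕₚ.+-monoʳ-< w i<j)) (ℕₚ.<⇒≤ (w+i<K j<)))
        seg₂≤ : All (_≤ℤ B w +ℤ B s) (seg₂ w s)
        seg₂≤ = Allₚ.applyUpTo⁺₁ _ w λ i<w → ℤₚ.+-monoˡ-≤ (B s) (B-mono-≤ i<w w≤K)
        seg₃≤ : All (_≤ℤ B w +ℤ B K) (seg₃ w s)
        seg₃≤ = Allₚ.applyUpTo⁺₁ _ _ λ i< → ℤₚ.+-monoʳ-≤ (B w) (B-mono-≤ (s+i<K i<) ℕₚ.≤-refl)
        s<seg₂ : All (B s <ℤ_) (seg₂ w s)
        s<seg₂ = Allₚ.applyUpTo⁺₁ _ w λ {i} i<w → subst (_<ℤ B (suc i) +ℤ B s) (ℤₚ.+-identityˡ (B s))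
          (ℤₚ.+-monoˡ-< (B s) (B-positive (s≤s z≤n) (ℕₚ.≤-trans i<w w≤K)))
        ws<seg₃ : All (B w +ℤ B s <ℤ_) (seg₃ w s)
        ws<seg₃ = Allₚ.applyUpTo⁺₁ _ _ λ {i} i< →
          ℤₚ.+-monoʳ-< (B w) (B-mono (s≤s (ℕₚ.m≤m+n s i)) (s+i<K i<))
        wK<seg₄ : All (B w +ℤ B K <ℤ_) (seg₄ w)
        wK<seg₄ = Allₚ.applyUpTo⁺₁ _ _ λ {i} i< → subst (_<ℤ B K +ℤ B (suc (w + i))) (ℤₚ.+-comm (B K) (B w))
          (ℤₚ.+-monoʳ-< (B K) (B-mono (s≤s (ℕₚ.m≤m+n w i)) (ℕₚ.<⇒≤ (w+i<K i<))))
        ws<seg₃₄ : All (B w +ℤ B s <ℤ_) (seg₃ w s ++ seg₄ w)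
        ws<seg₃₄ = Allₚ.++⁺ ws<seg₃ (lower (ℤₚ.+-monoʳ-≤ (B w) (B-mono-≤ s≤K ℕₚ.≤-refl)) wK<seg₄)
        inc₂₃₄ : Increasing (seg₂ w s ++ seg₃ w s ++ seg₄ w)
        inc₂₃₄ = Increasing-++ (B w +ℤ B s) inc₂
          (Increasing-++ (B w +ℤ B K) inc₃ inc₄ seg₃≤ wK<seg₄) seg₂≤ ws<seg₃₄
        s≤ws : B s ≤ℤ B w +ℤ B s
        s≤ws = subst (_≤ℤ B w +ℤ B s) (ℤₚ.+-identityˡ (B s)) (ℤₚ.+-monoˡ-≤ (B s) (B-nonneg w≤K))
        above-s : All (B s <ℤ_) (seg₂ w s ++ seg₃ w s ++ seg₄ w)
        above-s = Allₚ.++⁺ s<seg₂ (lower s≤ws ws<seg₃₄)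

      path-length : length (path w s) ≡ length below
      path-length = cong suc (begin
        length (vals B s ++ seg₂ w s ++ seg₃ w s ++ seg₄ w)
          ≡⟨ length-++ (vals B s) ⟩
        length (vals B s) + length (seg₂ w s ++ seg₃ w s ++ seg₄ w)
          ≡⟨ cong (_+_ (length (vals B s))) (length-++ (seg₂ w s)) ⟩
        length (vals B s) + (length (seg₂ w s) + length (seg₃ w s ++ seg₄ w))
          ≡⟨ cong (λ n → length (vals B s) + (length (seg₂ w s) + n)) (length-++ (seg₃ w s)) ⟩
        length (vals B s) + (length (seg₂ w s) + (length (seg₃ w s) + length (seg₄ w)))
          ≡⟨ cong₂ _+_ (length-applyUpTo _ s) (cong₂ _+_ (length-applyUpTo _ w)
               (cong₂ _+_ (length-applyUpTo _ (K ∸ s)) (length-applyUpTo _ (K′ ∸ w)))) ⟩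
        s + (w + ((K ∸ s) + (K′ ∸ w)))
          ≡⟨ solve 4 (λ s w a b → s :+ (w :+ (a :+ b)) := s :+ a :+ (w :+ b)) refl s w (K ∸ s) (K′ ∸ w) ⟩
        s + (K ∸ s) + (w + (K′ ∸ w))
          ≡⟨ cong₂ _+_ (ℕₚ.m+[n∸m]≡n s≤K) (ℕₚ.m+[n∸m]≡n w≤K′) ⟩
        K + K′
          ≡⟨ sym (cong₂ _+_ (length-applyUpTo (B ∘ suc) K)
               (trans (length-map (B K +ℤ_) (vals B K′)) (length-applyUpTo (B ∘ suc) K′))) ⟩
        length (vals B K) + length (map (B K +ℤ_) (vals B K′))
          ≡⟨ sym (length-++ (vals B K)) ⟩
        length (vals B K ++ map (B K +ℤ_) (vals B K′))
          ∎)
        where open ℕ-Solver.+-*-Solver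

      path≡below : path w s ≡ below
      path≡below = below-V-unique path-increasing path-sums path-≤V path-length

    step-law : ∀ s → 2 ≤ s → s ≤ K′ → B 1 +ℤ B s ≡ B (suc s)
    step-law s 2≤s s≤K′ = trans
      (after-common-prefix (+ 0 ∷ vals B s)
        (trans (path≡below 2≤s (ℕₚ.≤-trans s≤K′ (ℕₚ.n≤1+n K′))) below-split))
      (cong (B ∘ suc) (ℕₚ.+-identityʳ s))
      where
      d : ℕ
      d = K′ ∸ s
      M tail : List ℤ
      M = map (B K +ℤ_) (vals B K′)
      tail = applyUpTo (λ i → B (suc (s + suc i))) d ++ M
      K≡ : K ≡ s + suc d
      K≡ = trans (cong suc (sym (ℕₚ.m+[n∸m]≡n s≤K′))) (sym (ℕₚ.+-suc s d))
      below-split : below ≡ (+ 0 ∷ vals B s) ++ B (suc (s + 0)) ∷ tail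
      below-split = cong (+ 0 ∷_) (begin
        vals B K ++ M
          ≡⟨ cong (λ t → vals B t ++ M) K≡ ⟩
        vals B (s + suc d) ++ M
          ≡⟨ cong (_++ M) (applyUpTo-++ (B ∘ suc) s (suc d)) ⟩
        (vals B s ++ applyUpTo (λ i → B (suc (s + i))) (suc d)) ++ M
          ≡⟨ ++-assoc (vals B s) _ M ⟩
        vals B s ++ B (suc (s + 0)) ∷ tail
          ∎)

    exchange-law : B 2 +ℤ B 3 ≡ B 1 +ℤ B 4
    exchange-law = just-injective (cong (head ∘ drop 5)
      (trans (path≡below (s≤s (s≤s (s≤s z≤n))) 3≤K) (sym (path≡below (s≤s (s≤s z≤n)) 3≤K))))
      where
      3≤K : 3 ≤ K
      3≤K = s≤s (s≤s (s≤s z≤n))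

    B₂≡B₁+B₁ : B 2 ≡ B 1 +ℤ B 1
    B₂≡B₁+B₁ = ∙-cancelʳ (B 3) (B 2) (B 1 +ℤ B 1) (begin
      B 2 +ℤ B 3          ≡⟨ exchange-law ⟩
      B 1 +ℤ B 4          ≡⟨ cong (B 1 +ℤ_) (sym (step-law 3 (s≤s (s≤s z≤n)) (s≤s (s≤s (s≤s z≤n))))) ⟩
      B 1 +ℤ (B 1 +ℤ B 3) ≡⟨ sym (ℤₚ.+-assoc (B 1) (B 1) (B 3)) ⟩
      B 1 +ℤ B 1 +ℤ B 3   ∎)

    linear : ∀ t → t ≤ K → B t ≡ B 1 *ℤ + t
    linear zero _ = trans B-zero (sym (ℤₚ.*-zeroʳ (B 1)))
    linear (suc zero) _ = sym (ℤₚ.*-identityʳ (B 1))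
    linear (suc (suc zero)) _ =
      trans B₂≡B₁+B₁ (trans (cong (B 1 +ℤ_) (sym (ℤₚ.*-identityʳ (B 1)))) (sym (ℤₚ.*-suc (B 1) (+ 1))))
    linear (suc (suc (suc t))) 3+t≤K = begin
      B (3 + t)                ≡⟨ sym (step-law (2 + t) (s≤s (s≤s z≤n)) (ℕₚ.≤-pred 3+t≤K)) ⟩
      B 1 +ℤ B (2 + t)         ≡⟨ cong (B 1 +ℤ_) (linear (suc (suc t)) (ℕₚ.≤-trans (ℕₚ.n≤1+n _) 3+t≤K)) ⟩
      B 1 +ℤ B 1 *ℤ + (2 + t)  ≡⟨ sym (ℤₚ.*-suc (B 1) (+ (2 + t))) ⟩
      B 1 *ℤ + (3 + t)         ∎

-- Extremal sequences

extremal-count : ∀ {k} (r : Fin k → ℕ) j α → j < k →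
  prefixSum j r ≤ α → α < prefixSum (suc j) r → α ≤ totalSum r →
  (totalSum (weighted r) ∸ prefixSum (suc j) (weighted r)) + j * (prefixSum (suc j) r ∸ α) + 1
    ≡ suc (sumℕ (take (totalSum r ∸ α) (indices↓ k r)))
extremal-count {k} r j α j<k P≤α α<P α≤n = trans (ℕₚ.+-comm _ 1) (cong suc (ℕₚ.+-cancelʳ-≡ PW _ _ (begin
  TW ∸ PW + j * δ + PW    ≡⟨ solve 3 (λ a b c → a :+ b :+ c := a :+ c :+ b) refl (TW ∸ PW) (j * δ) PW ⟩
  TW ∸ PW + PW + j * δ    ≡⟨ cong (_+ j * δ) (ℕₚ.m∸n+n≡m (prefixSum≤totalSum (suc j) (weighted r))) ⟩
  TW + j * δ              ≡⟨ sym (sum-largest k r j (n ∸ α) δ j<k δ≤ β+P≡n+δ) ⟩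
  sumℕ (take (n ∸ α) (indices↓ k r)) + PW ∎)))
  where
  open ℕ-Solver.+-*-Solver
  n TW PW δ : ℕ
  n = totalSum r
  TW = totalSum (weighted r)
  PW = prefixSum (suc j) (weighted r)
  δ = prefixSum (suc j) r ∸ α
  α+δ≡P : α + δ ≡ prefixSum (suc j) r
  α+δ≡P = ℕₚ.m+[n∸m]≡n (ℕₚ.<⇒≤ α<P)
  δ≤ : prefixSum j r + δ ≤ prefixSum (suc j) r
  δ≤ = subst (prefixSum j r + δ ≤_) α+δ≡P (ℕₚ.+-monoˡ-≤ δ P≤α)
  β+P≡n+δ : n ∸ α + prefixSum (suc j) r ≡ n + δ
  β+P≡n+δ = begin
    n ∸ α + prefixSum (suc j) r ≡⟨ cong (_+_ (n ∸ α)) (sym α+δ≡P) ⟩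
    n ∸ α + (α + δ)             ≡⟨ sym (ℕₚ.+-assoc (n ∸ α) α δ) ⟩
    n ∸ α + α + δ               ≡⟨ cong (_+ δ) (ℕₚ.m∸n+n≡m α≤n) ⟩
    n + δ                       ∎

Sums⇒complement∈Σ : ∀ k (r : Fin k → ℕ) a {α β x} → α + β ≡ totalSum r →
  Sums (extend (+ 0) a) (indices↓ k r) β x → InSigma α (expand r a) (sumℤ (expand r a) -ℤ x)
Sums⇒complement∈Σ k r a {α} {β} α+β≡n (R , R⊆ds , R≤β , ΣR) =
  subst (λ y → InSigma α (expand r a) (sumℤ (expand r a) -ℤ y)) (trans (sumℤ-reverse (map B R)) ΣR)
    (complement∈Σ R⊆E R≤β′ (trans α+β≡n (sym length-E)))
  where
  B : ℕ → ℤ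
  B = extend (+ 0) a
  R⊆E : reverse (map B R) ⊆ expand r a
  R⊆E = subst (reverse (map B R) ⊆_) (sym (expand-indices↓ k r a)) (Sublist.reverse⁺ (Sublist.map⁺ B R⊆ds))
  R≤β′ : length (reverse (map B R)) ≤ β
  R≤β′ = subst (_≤ β) (sym (trans (length-reverse (map B R)) (length-map B R))) R≤β
  length-E : length (expand r a) ≡ totalSum r
  length-E = trans (cong length (expand-indices↓ k r a))
    (trans (length-reverse (map B (indices↓ k r))) (trans (length-map B (indices↓ k r)) (length-indices↓ k r)))

extremal⇒linear : ∀ K₀ (r : Fin (5 + K₀) → ℕ) → (∀ i → 1 ≤ r i) → ∀ α → α + 2 ≤ totalSum r →
  (a : Fin (5 + K₀) → ℤ) → a F.zero ≡ + 0 → (∀ i j → i F.< j → a i <ℤ a j) →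
  HasCard (InSigma α (expand r a)) (suc (sumℕ (take (totalSum r ∸ α) (indices↓ (5 + K₀) r)))) →
  ∀ t → t ≤ 4 + K₀ → extend (+ 0) a t ≡ extend (+ 0) a 1 *ℤ + t
extremal⇒linear K₀ r r-pos α α+2≤n a a₀ a-mono (L , _ , L↔Σ , L-length)
  with indices↓-top-two (3 + K₀) r r-pos
... | u , rest , top , K′≤u = Rigidity.linear K₀ B a₀ (extend-strictMono a a-mono) u rest (β ∸ 2) K′≤u
  (subst (All (_≤ 4 + K₀)) top (All.map ℕₚ.≤-pred (indices↓-bounded (5 + K₀) r)))
  (subst SuffixesDownClosed top (indices↓-closed (5 + K₀) r r-pos))
  (map (T -ℤ_) L) cover small
  where
  B : ℕ → ℤ
  B = extend (+ 0) a
  T : ℤ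
  T = sumℤ (expand r a)
  β : ℕ
  β = totalSum r ∸ α
  β≡ : β ≡ 2 + (β ∸ 2)
  β≡ = sym (ℕₚ.m+[n∸m]≡n (ℕₚ.m+n≤o⇒m≤o∸n 2 (subst (_≤ totalSum r) (ℕₚ.+-comm α 2) α+2≤n)))
  T-[T-x]≡x : ∀ x → T -ℤ (T -ℤ x) ≡ x
  T-[T-x]≡x x = solve 2 (λ T x → T :- (T :- x) := x) refl T x
    where open ℤ-Solver.+-*-Solver
  cover : ∀ {x} → Sums B (4 + K₀ ∷ u ∷ rest) (2 + (β ∸ 2)) x → x ∈ map (T -ℤ_) L
  cover {x} Dx = subst (_∈ map (T -ℤ_) L) (T-[T-x]≡x x) (∈-map⁺ (T -ℤ_) (Equivalence.from (L↔Σ _)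
    (Sums⇒complement∈Σ (5 + K₀) r a (ℕₚ.m+[n∸m]≡n (ℕₚ.m+n≤o⇒m≤o α α+2≤n))
      (subst₂ (λ ds β′ → Sums B ds β′ x) (sym top) (sym β≡) Dx))))
  small : length (map (T -ℤ_) L) ≤ suc (sumℕ (take (2 + (β ∸ 2)) (4 + K₀ ∷ u ∷ rest)))
  small = ℕₚ.≤-reflexive (trans (length-map (T -ℤ_) L)
    (trans L-length (cong₂ (λ β′ ds → suc (sumℕ (take β′ ds))) β≡ top)))

expand-cong : ∀ {k} (r : Fin k → ℕ) {a b : Fin k → ℤ} → (∀ i → a i ≡ b i) → expand r a ≡ expand r b
expand-cong {k} r a≡b = cong concat (map-cong (λ i → cong (replicate (r i)) (a≡b i)) (allFin k))

corollary3p6 : (k : ℕ) → 5 ≤ k →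
  (r : Fin k → ℕ) → (∀ i → 1 ≤ r i) →
  (α : ℕ) → α + 2 ≤ totalSum r →
  (m : ℕ) → 1 ≤ m → m ≤ k →
  prefixSum (m ∸ 1) r ≤ α → α < prefixSum m r →
  (a : Fin k → ℤ) →
  (∀ i → toℕ i ≡ 0 → a i ≡ + 0) →
  (∀ i j → i F.< j → a i ℤ.< a j) →
  HasCard (InSigma α (expand r a))
    ((totalSum (λ i → toℕ i * r i) ∸ prefixSum m (λ i → toℕ i * r i))
      + (m ∸ 1) * (prefixSum m r ∸ α) + 1) →
  ∀ j → toℕ j ≡ 1 → expand r a ≡ expand r (λ i → a j ℤ.* (+ toℕ i))
corollary3p6 (suc (suc (suc (suc (suc K₀))))) (s≤s (s≤s (s≤s (s≤s (s≤s _))))) r r-pos α α+2≤n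
  (suc j) (s≤s z≤n) j<k P≤α α<P a a₀ a-mono card i i≡1 =
  expand-cong r λ t → begin
    a t             ≡⟨ sym (extend-toℕ (+ 0) a t) ⟩
    B (toℕ t)       ≡⟨ linear (toℕ t) (ℕₚ.≤-pred (toℕ<n t)) ⟩
    B 1 *ℤ + toℕ t  ≡⟨ cong (_*ℤ + toℕ t) (trans (cong B (sym i≡1)) (extend-toℕ (+ 0) a i)) ⟩
    a i *ℤ + toℕ t  ∎
  where
  B : ℕ → ℤ
  B = extend (+ 0) a
  card′ : HasCard (InSigma α (expand r a)) (suc (sumℕ (take (totalSum r ∸ α) (indices↓ (5 + K₀) r))))
  card′ = subst (HasCard (InSigma α (expand r a)))
    (extremal-count r j α j<k P≤α α<P (ℕₚ.m+n≤o⇒m≤o α α+2≤n)) card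
  linear : ∀ t → t ≤ 4 + K₀ → B t ≡ B 1 *ℤ + t
  linear = extremal⇒linear K₀ r r-pos α α+2≤n a (a₀ F.zero refl) a-mono card′
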